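{- Let $\mathsf{L}$ be a relevant modal logic determined by a set $\Phi$ of frame conditions from the table below, and let $\mathbf{M}$ be an $L$-model based on an $\mathsf{L}$-frame, with set of states $S$. Then there is a $\mathsf{CL}$-model $\mathbf{M}'$ (a $W$-model based on a $\mathsf{CL}$-frame) whose set of states $S'$ satisfies $S'\supsetneq S$, such that for all formulas $\varphi$: (1) for all $s\in S$, $(\mathbf{M},s)\models\varphi$ iff $(\mathbf{M}',s)\models\varphi$; (2) if $\varphi$ is not valid in $\mathbf{M}$, then $\Box_L\varphi$ is not valid in $\mathbf{M}'$.
   Context: Language: a countable set $Pr$ of propositional variables, binary connectives $\land,\lor,\to$ and unary connectives $\neg,\Box,\Box_L$; $\varphi\leftrightarrow\psi:=(\varphi\to\psi)\land(\psi\to\varphi)$. Frames and interpretation. A frame is $F=(S,\leq,R,*,Q,Q_L)$ where $(S,\leq)$ is a partially ordered set; $R\subseteq S^3$ satisfies: if $Rstu$, $s'\leq s$, $t'\leq t$, $u\leq u'$ then $Rs't'u'$; $*:S\to S$ satisfies $s\leq t\Rightarrow t^*\leq s^*$; $Q,Q_L\subseteq S^2$ satisfy: if $Qst$, $s'\leq s$, $t\leq t'$ then $Qs't'$ (same for $Q_L$). A valuation $V$ maps each $p$ to an up-set. $[\![p]\!]=V(p)$; $\land$ intersection, $\lor$ union; $[\![\neg\varphi]\!]=\{s: s^*\notin[\![\varphi]\!]\}$; $[\![\varphi\to\psi]\!]=\{s:\forall t,u\,(Rstu \text{ and } t\in[\![\varphi]\!]\Rightarrow u\in[\![\psi]\!])\}$;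 $[\![\Box\varphi]\!]=\{s:\forall t\,(Qst\Rightarrow t\in[\![\varphi]\!])\}$; $[\![\Box_L\varphi]\!]$ likewise with $Q_L$. $(M,s)\models\varphi$ means $s\in[\![\varphi]\!]$. $L$-frames. An $L$-frame is $(F,L)$ with $L\subseteq S$ an up-set such that for every $s$ there is $x\in L$ with $Rxss$, and $s\in L$, $Rstu$ imply $t\le u$. An $L$-model adds a valuation; $\varphi$ is valid in it iff $L\subseteq[\![\varphi]\!]$. $W$-frames. A frame is bounded if $(S,\le)$ has least element $0$ and greatest $1$ and $1^*=0$, $0^*=1$, $Q00$, $Q_L00$, $Q1s\Rightarrow s=1$, $Q_L1s\Rightarrow s=1$, $R010$, $R1st\Rightarrow(s=0$ or $t=1)$. A possible world is $w$ with $w^*=w$, $Rwww$, $Rwst\Rightarrow(s=0$ or $w\le t)$, $Rwst\Rightarrow(t=1$ or $s\le w^*)$. A $W$-frame is $(F,W)$ with $F$ bounded, $W$ a set of possible worlds, such that (a) for $w\in W$: $Q_Lwu$ and $Rust$ imply $s\le t$; (b) for every $s$ there are $w\in W$, $u$ with $Q_Lwu$ and $Russ$. A $W$-model is a $W$-frame with a valuation whose values are up-sets containing $1$ and not $0$; $\varphi$ is valid in it iff $W\subseteq[\![\varphi]\!]$. Frame conditions (all free variables universally quantified; $Rstuv:=\exists x(Rstx\,\&\,Rxuv)$, $Rs(tu)v:=\exists x(Rtux\,\&\,Rsxv)$, $RQstu:=\exists x(Rstx\,\&\,Qxu)$, $QRstu:=\exists x(Qsx\,\&\,Rxtu)$):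 (DN) $s^{**}=s$; (Cp) $Rstu\Rightarrow Rsu^*t^*$; (WB) $Rstu\Rightarrow Rs(st)u$; (X) $s\in L\Rightarrow s^*\le s$; (Rd) $Rss^*s$; (B) $Rstuv\Rightarrow Rs(tu)v$; (CB) $Rstuv\Rightarrow Rt(su)v$; (W) $Rstu\Rightarrow Rsttu$; (C) $Rstuv\Rightarrow Rsutv$; (M) $Rstu\Rightarrow(s\le u$ or $t\le u)$; (ER) $\exists x(x\in L\,\&\,Rsxs)$; (Nec) $(x\in L\,\&\,Qxs)\Rightarrow s\in L$; ($\Box$K) $RQstu\Rightarrow\exists x(Qtx\,\&\,QRsxu)$; ($\Box$T) $Qss$; ($\Box$D) $\exists x(Qsx^*\,\&\,Qs^*x)$; ($\Box$4) $(Qst\,\&\,Qtu)\Rightarrow Qsu$; ($\Box$5) $(Qs^*u\,\&\,Qst)\Rightarrow Qt^*u$. Logics. For a chosen set $\Phi$ of these conditions, an $\mathsf{L}$-frame is an $L$-frame satisfying $\Phi$; an $L$-model for $\mathsf{L}$ is an $L$-model on an $\mathsf{L}$-frame. The C-variant of a condition replaces every occurrence of "$s\in L$" by "$\exists w(w\in W\,\&\,Q_Lws)$" with $w$ fresh (conditions without $L$ are unchanged). A $\mathsf{CL}$-frame is a $W$-frame satisfying the C-variants of the conditions in $\Phi$; a $\mathsf{CL}$-model is a $W$-model on a $\mathsf{CL}$-frame. -}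

module Defs where

open import Data.Nat using (ℕ)
open import Data.Product using (Σ; ∃; ∃-syntax; _×_; _,_)
open import Data.Sum using (_⊎_)
open import Relation.Nullary using (¬_)
open import Relation.Binary.PropositionalEquality using (_≡_)
open import Relation.Binary.Structures using (IsPartialOrder)
open import Function.Bundles using (_⇔_)

data Fm : Set where
  atom : ℕ → Fm
  and or imp : Fm → Fm → Fm
  neg box boxL : Fm → Fm

record Frame : Set₁ where
  infix 4 _≤_
  field
    S       : Set
    _≤_     : S → S → Set
    isPO    : IsPartialOrder _≡_ _≤_
    R       : S → S → S → Set
    R-mono  : ∀ {s t u s' t' u'} → R s t u → s' ≤ s → t' ≤ t → u ≤ u' → R s' t' u'
    _*      : S → S
    *-anti  : ∀ {s t} → s ≤ t → (t *) ≤ (s *)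
    Q       : S → S → Set
    QL      : S → S → Set
    Q-mono  : ∀ {s t s' t'} → Q s t → s' ≤ s → t ≤ t' → Q s' t'
    QL-mono : ∀ {s t s' t'} → QL s t → s' ≤ s → t ≤ t' → QL s' t'

module _ (F : Frame) where
  open Frame F

  UpSet : (S → Set) → Set
  UpSet X = ∀ {s t} → s ≤ t → X s → X t

  sem : (ℕ → S → Set) → Fm → S → Set
  sem V (atom p)  s = V p s
  sem V (and φ ψ) s = sem V φ s × sem V ψ s
  sem V (or φ ψ)  s = sem V φ s ⊎ sem V ψ s
  sem V (imp φ ψ) s = ∀ t u → R s t u → sem V φ t → sem V ψ u
  sem V (neg φ)   s = ¬ sem V φ (s *)
  sem V (box φ)   s = ∀ t → Q s t → sem V φ t
  sem V (boxL φ)  s = ∀ t → QL s t → sem V φ t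

  R4 : S → S → S → S → Set
  R4 s t u v = ∃[ x ] (R s t x × R x u v)
  Rp : S → S → S → S → Set
  Rp s t u v = ∃[ x ] (R t u x × R s x v)
  RQ : S → S → S → Set
  RQ s t u = ∃[ x ] (R s t x × Q x u)
  QR : S → S → S → Set
  QR s t u = ∃[ x ] (Q s x × R x t u)

data Cond : Set where
  DN Cp WB X Rd B CB W C M ER Nec BoxK BoxT BoxD Box4 Box5 : Cond

-- `Holds c F D` is condition c on frame F, where D is the predicate
-- playing the role of "s ∈ L".  For L-frames D = L; the C-variant is
-- obtained with D s = ∃ w (w ∈ W × Q_L w s).
Holds : Cond → (F : Frame) → (Frame.S F → Set) → Set
Holds c F D = go c
  where
  open Frame F
  go : Cond → Set
  go DN   = ∀ s → ((s *) *) ≡ s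
  go Cp   = ∀ {s t u} → R s t u → R s (u *) (t *)
  go WB   = ∀ {s t u} → R s t u → Rp F s s t u
  go X    = ∀ {s} → D s → (s *) ≤ s
  go Rd   = ∀ s → R s (s *) s
  go B    = ∀ {s t u v} → R4 F s t u v → Rp F s t u v
  go CB   = ∀ {s t u v} → R4 F s t u v → Rp F t s u v
  go W    = ∀ {s t u} → R s t u → R4 F s t t u
  go C    = ∀ {s t u v} → R4 F s t u v → R4 F s u t v
  go M    = ∀ {s t u} → R s t u → (s ≤ u) ⊎ (t ≤ u)
  go ER   = ∀ s → ∃[ x ] (D x × R s x s)
  go Nec  = ∀ {x s} → D x → Q x s → D s
  go BoxK = ∀ {s t u} → RQ F s t u → ∃[ x ] (Q t x × QR F s x u)
  go BoxT = ∀ s → Q s s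
  go BoxD = ∀ s → ∃[ x ] (Q s (x *) × Q (s *) x)
  go Box4 = ∀ {s t u} → Q s t → Q t u → Q s u
  go Box5 = ∀ {s t u} → Q (s *) u → Q s t → Q (t *) u

record LFrame : Set₁ where
  field
    frame : Frame
  open Frame frame public
  field
    L     : S → Set
    L-up  : UpSet frame L
    L-id  : ∀ s → ∃[ x ] (L x × R x s s)
    L-R   : ∀ {s t u} → L s → R s t u → t ≤ u

record LModel : Set₁ where
  field
    lframe : LFrame
  open LFrame lframe public
  field
    V     : ℕ → S → Set
    V-up  : ∀ p → UpSet frame (V p)

  ⟦_⟧ : Fm → S → Set
  ⟦ φ ⟧ = sem frame V φ

ValidL : LModel → Fm → Set
ValidL Mo φ = ∀ s → L s → ⟦ φ ⟧ s
  where open LModel Mo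

HoldsL : (Cond → Set) → LModel → Set
HoldsL Φ Mo = ∀ c → Φ c → Holds c (LModel.frame Mo) (LModel.L Mo)

record Bounded (F : Frame) : Set where
  open Frame F
  field
    bot top   : S
    bot-least : ∀ s → bot ≤ s
    top-great : ∀ s → s ≤ top
    top*      : (top *) ≡ bot
    bot*      : (bot *) ≡ top
    Q-bot     : Q bot bot
    QL-bot    : QL bot bot
    Q-top     : ∀ {s} → Q top s → s ≡ top
    QL-top    : ∀ {s} → QL top s → s ≡ top
    R-bot     : R bot top bot
    R-top     : ∀ {s t} → R top s t → (s ≡ bot) ⊎ (t ≡ top)

record PossibleWorld (F : Frame) (Bd : Bounded F) (w : Frame.S F) : Set where
  open Frame F
  open Bounded Bd
  field
    w*   : (w *) ≡ w
    Rwww : R w w w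
    pw1  : ∀ {s t} → R w s t → (s ≡ bot) ⊎ (w ≤ t)
    pw2  : ∀ {s t} → R w s t → (t ≡ top) ⊎ (s ≤ (w *))

record WFrame : Set₁ where
  field
    frame   : Frame
    bounded : Bounded frame
  open Frame frame public
  open Bounded bounded public
  field
    Wd    : S → Set
    W-pw  : ∀ {w} → Wd w → PossibleWorld frame bounded w
    W-a   : ∀ {w u s t} → Wd w → QL w u → R u s t → s ≤ t
    W-b   : ∀ s → ∃[ w ] ∃[ u ] (Wd w × QL w u × R u s s)

  LC : S → Set
  LC s = ∃[ w ] (Wd w × QL w s)

record WModel : Set₁ where
  field
    wframe : WFrame
  open WFrame wframe public
  field
    V      : ℕ → S → Set
    V-up   : ∀ p → UpSet frame (V p)
    V-top  : ∀ p → V p top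
    V-bot  : ∀ p → ¬ V p bot

  ⟦_⟧ : Fm → S → Set
  ⟦ φ ⟧ = sem frame V φ

ValidW : WModel → Fm → Set
ValidW Mo φ = ∀ w → Wd w → ⟦ φ ⟧ w
  where open WModel Mo

HoldsC : (Cond → Set) → WModel → Set
HoldsC Φ Mo = ∀ c → Φ c → Holds c (WModel.frame Mo) (WModel.LC Mo)

-- Adjoin to M a least state ⊥, a greatest state ⊤ and one possible world w, with w* = w.
-- Relations among old states are those of M; otherwise R x y z holds iff x = ⊥, y = ⊥,
-- z = ⊤ or x = y = z = w, and Q, Q_L hold out of ⊥, into ⊤ and from w to w; in
-- addition Q_L w s for every s ∈ L.  Thus w ⊨ □_L φ forces φ at all of L, and the
-- C-variant "∃ w'. w' ∈ W ∧ Q_L w' s" holds exactly at ⊤, at w and at the old states of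
-- L, which makes each frame condition of M transfer case by case.  Every formula holds
-- at ⊤ and fails at ⊥, so truth at the old states is unchanged.

module Submission where

open import Defs
open import Data.Empty using (⊥; ⊥-elim)
open import Data.Nat using (ℕ)
open import Data.Product using (Σ; ∃-syntax; _×_; _,_)
open import Data.Product.Function.NonDependent.Propositional using (_×-⇔_)
open import Data.Sum using (_⊎_; inj₁; inj₂)
open import Data.Sum.Function.Propositional using (_⊎-⇔_)
open import Data.Unit using (⊤; tt)
open import Function.Bundles using (_⇔_; mk⇔; module Equivalence)
open import Function.Construct.Identity using (⇔-id)
open import Function.Related.TypeIsomorphisms using (¬-cong-⇔)
open import Relation.Nullary using (¬_)
open import Relation.Binary.PropositionalEquality using (_≡_; refl; cong; isEquivalence)
open import Relation.Binary.Structures using (IsPartialOrder)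

module _ (Mo : WModel) where
  open WModel Mo

  mutual
    top-satisfies-all : ∀ φ → ⟦ φ ⟧ top
    top-satisfies-all (atom p)  = V-top p
    top-satisfies-all (and φ ψ) = top-satisfies-all φ , top-satisfies-all ψ
    top-satisfies-all (or φ ψ)  = inj₁ (top-satisfies-all φ)
    top-satisfies-all (imp φ ψ) t u r φt with R-top r
    ... | inj₁ refl = ⊥-elim (bot-satisfies-none φ φt)
    ... | inj₂ refl = top-satisfies-all ψ
    top-satisfies-all (neg φ) rewrite top* = bot-satisfies-none φ
    top-satisfies-all (box φ)  t q rewrite Q-top q  = top-satisfies-all φ
    top-satisfies-all (boxL φ) t q rewrite QL-top q = top-satisfies-all φ

    bot-satisfies-none : ∀ φ → ¬ ⟦ φ ⟧ bot
    bot-satisfies-none (atom p)         = V-bot p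
    bot-satisfies-none (and φ ψ) (φ⊥ , _) = bot-satisfies-none φ φ⊥
    bot-satisfies-none (or φ ψ) (inj₁ φ⊥) = bot-satisfies-none φ φ⊥
    bot-satisfies-none (or φ ψ) (inj₂ ψ⊥) = bot-satisfies-none ψ ψ⊥
    bot-satisfies-none (imp φ ψ) f      = bot-satisfies-none ψ (f top bot R-bot (top-satisfies-all φ))
    bot-satisfies-none (neg φ) ¬φ rewrite bot* = ¬φ (top-satisfies-all φ)
    bot-satisfies-none (box φ)  f       = bot-satisfies-none φ (f bot Q-bot)
    bot-satisfies-none (boxL φ) f       = bot-satisfies-none φ (f bot QL-bot)

module Extension (𝔽 : LFrame) where
  module 𝔽 = LFrame 𝔽
  module ≤ = IsPartialOrder 𝔽.isPO

  data S⁺ : Set where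
    bot top world : S⁺
    ι : 𝔽.S → S⁺

  ι-injective : ∀ {s t} → ι s ≡ ι t → s ≡ t
  ι-injective refl = refl

  world-∉-image : ∀ s → ¬ (ι s ≡ world)
  world-∉-image s ()

  infix 4 _≤⁺_
  data _≤⁺_ : S⁺ → S⁺ → Set where
    ⊥≤  : ∀ {x} → bot ≤⁺ x
    ≤⊤  : ∀ {x} → x ≤⁺ top
    w≤w : world ≤⁺ world
    ι≤ι : ∀ {s t} → s 𝔽.≤ t → ι s ≤⁺ ι t

  ≤⁺-refl : ∀ x → x ≤⁺ x
  ≤⁺-refl bot   = ⊥≤
  ≤⁺-refl top   = ≤⊤
  ≤⁺-refl world = w≤w
  ≤⁺-refl (ι s) = ι≤ι ≤.refl

  ≤⁺-trans : ∀ {x y z} → x ≤⁺ y → y ≤⁺ z → x ≤⁺ z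
  ≤⁺-trans ⊥≤      _       = ⊥≤
  ≤⁺-trans _       ≤⊤      = ≤⊤
  ≤⁺-trans w≤w     w≤w     = w≤w
  ≤⁺-trans (ι≤ι p) (ι≤ι q) = ι≤ι (≤.trans p q)

  ≤⁺-antisym : ∀ {x y} → x ≤⁺ y → y ≤⁺ x → x ≡ y
  ≤⁺-antisym ⊥≤      ⊥≤      = refl
  ≤⁺-antisym ≤⊤      ≤⊤      = refl
  ≤⁺-antisym w≤w     w≤w     = refl
  ≤⁺-antisym (ι≤ι p) (ι≤ι q) = cong ι (≤.antisym p q)

  ≤⁺-isPartialOrder : IsPartialOrder _≡_ _≤⁺_
  ≤⁺-isPartialOrder = record
    { isPreorder = record
      { isEquivalence = isEquivalence
      ; reflexive     = λ { refl → ≤⁺-refl _ }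
      ; trans         = ≤⁺-trans
      }
    ; antisym = ≤⁺-antisym
    }

  data R⁺ : S⁺ → S⁺ → S⁺ → Set where
    R⊥₁ : ∀ {y z} → R⁺ bot y z
    R⊥₂ : ∀ {x z} → R⁺ x bot z
    R⊤₃ : ∀ {x y} → R⁺ x y top
    Rww : R⁺ world world world
    Rι  : ∀ {s t u} → 𝔽.R s t u → R⁺ (ι s) (ι t) (ι u)

  R⁺-mono : ∀ {s t u s' t' u'} → R⁺ s t u → s' ≤⁺ s → t' ≤⁺ t → u ≤⁺ u' → R⁺ s' t' u'
  R⁺-mono R⊥₁    ⊥≤      _       _       = R⊥₁
  R⁺-mono R⊥₂    _       ⊥≤      _       = R⊥₂
  R⁺-mono R⊤₃    _       _       ≤⊤      = R⊤₃
  R⁺-mono _      ⊥≤      _       _       = R⊥₁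
  R⁺-mono _      _       ⊥≤      _       = R⊥₂
  R⁺-mono _      _       _       ≤⊤      = R⊤₃
  R⁺-mono Rww    w≤w     w≤w     w≤w     = Rww
  R⁺-mono (Rι r) (ι≤ι p) (ι≤ι q) (ι≤ι o) = Rι (𝔽.R-mono r p q o)

  _*⁺ : S⁺ → S⁺
  bot *⁺   = top
  top *⁺   = bot
  world *⁺ = world
  ι s *⁺   = ι (s 𝔽.*)

  *⁺-anti : ∀ {s t} → s ≤⁺ t → (t *⁺) ≤⁺ (s *⁺)
  *⁺-anti ⊥≤      = ≤⊤
  *⁺-anti ≤⊤      = ⊥≤
  *⁺-anti w≤w     = w≤w
  *⁺-anti (ι≤ι p) = ι≤ι (𝔽.*-anti p)

  data Q⁺ : S⁺ → S⁺ → Set where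
    Q⊥  : ∀ {y} → Q⁺ bot y
    Q⊤  : ∀ {x} → Q⁺ x top
    Qww : Q⁺ world world
    Qι  : ∀ {s t} → 𝔽.Q s t → Q⁺ (ι s) (ι t)

  Q⁺-mono : ∀ {s t s' t'} → Q⁺ s t → s' ≤⁺ s → t ≤⁺ t' → Q⁺ s' t'
  Q⁺-mono Q⊥     ⊥≤      _       = Q⊥
  Q⁺-mono Q⊤     _       ≤⊤      = Q⊤
  Q⁺-mono _      ⊥≤      _       = Q⊥
  Q⁺-mono _      _       ≤⊤      = Q⊤
  Q⁺-mono Qww    w≤w     w≤w     = Qww
  Q⁺-mono (Qι q) (ι≤ι p) (ι≤ι o) = Qι (𝔽.Q-mono q p o)

  data QL⁺ : S⁺ → S⁺ → Set where
    QL⊥  : ∀ {y} → QL⁺ bot y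
    QL⊤  : ∀ {x} → QL⁺ x top
    QLww : QL⁺ world world
    QLι  : ∀ {s t} → 𝔽.QL s t → QL⁺ (ι s) (ι t)
    QL-L : ∀ {t} → 𝔽.L t → QL⁺ world (ι t)

  QL⁺-mono : ∀ {s t s' t'} → QL⁺ s t → s' ≤⁺ s → t ≤⁺ t' → QL⁺ s' t'
  QL⁺-mono QL⊥      ⊥≤      _       = QL⊥
  QL⁺-mono QL⊤      _       ≤⊤      = QL⊤
  QL⁺-mono _        ⊥≤      _       = QL⊥
  QL⁺-mono _        _       ≤⊤      = QL⊤
  QL⁺-mono QLww     w≤w     w≤w     = QLww
  QL⁺-mono (QLι q)  (ι≤ι p) (ι≤ι o) = QLι (𝔽.QL-mono q p o)
  QL⁺-mono (QL-L l) w≤w     (ι≤ι o) = QL-L (𝔽.L-up o l)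

  frame⁺ : Frame
  frame⁺ = record
    { S = S⁺ ; _≤_ = _≤⁺_ ; isPO = ≤⁺-isPartialOrder ; R = R⁺ ; R-mono = R⁺-mono
    ; _* = _*⁺ ; *-anti = *⁺-anti ; Q = Q⁺ ; QL = QL⁺ ; Q-mono = Q⁺-mono ; QL-mono = QL⁺-mono
    }

  bounded⁺ : Bounded frame⁺
  bounded⁺ = record
    { bot = bot ; top = top ; bot-least = λ _ → ⊥≤ ; top-great = λ _ → ≤⊤
    ; top* = refl ; bot* = refl ; Q-bot = Q⊥ ; QL-bot = QL⊥
    ; Q-top = λ { Q⊤ → refl } ; QL-top = λ { QL⊤ → refl } ; R-bot = R⊥₁
    ; R-top = λ { R⊥₂ → inj₁ refl ; R⊤₃ → inj₂ refl }
    }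

  world-possible : PossibleWorld frame⁺ bounded⁺ world
  world-possible = record
    { w* = refl
    ; Rwww = Rww
    ; pw1 = λ { R⊥₂ → inj₁ refl ; R⊤₃ → inj₂ ≤⊤ ; Rww → inj₂ w≤w }
    ; pw2 = λ { R⊥₂ → inj₂ ⊥≤ ; R⊤₃ → inj₁ refl ; Rww → inj₂ w≤w }
    }

  IsWorld : S⁺ → Set
  IsWorld x = x ≡ world

  world-logical : ∀ {w u s t} → IsWorld w → QL⁺ w u → R⁺ u s t → s ≤⁺ t
  world-logical refl _        R⊥₂    = ⊥≤
  world-logical refl _        R⊤₃    = ≤⊤
  world-logical refl QLww     Rww    = w≤w
  world-logical refl (QL-L l) (Rι r) = ι≤ι (𝔽.L-R l r)

  world-identity : ∀ s → ∃[ w ] ∃[ u ] (IsWorld w × QL⁺ w u × R⁺ u s s)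
  world-identity bot   = world , world , refl , QLww , R⊥₂
  world-identity top   = world , world , refl , QLww , R⊤₃
  world-identity world = world , world , refl , QLww , Rww
  world-identity (ι s) with 𝔽.L-id s
  ... | x , l , r = world , ι x , refl , QL-L l , Rι r

  wframe⁺ : WFrame
  wframe⁺ = record
    { frame = frame⁺ ; bounded = bounded⁺ ; Wd = IsWorld
    ; W-pw = λ { refl → world-possible } ; W-a = world-logical ; W-b = world-identity
    }

  LC⁺ : S⁺ → Set
  LC⁺ = WFrame.LC wframe⁺

  lift-DN : Holds DN 𝔽.frame 𝔽.L → Holds DN frame⁺ LC⁺
  lift-DN h bot   = refl
  lift-DN h top   = refl
  lift-DN h world = refl
  lift-DN h (ι s) = cong ι (h s)

  lift-Cp : Holds Cp 𝔽.frame 𝔽.L → Holds Cp frame⁺ LC⁺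
  lift-Cp h R⊥₁    = R⊥₁
  lift-Cp h R⊥₂    = R⊤₃
  lift-Cp h R⊤₃    = R⊥₂
  lift-Cp h Rww    = Rww
  lift-Cp h (Rι r) = Rι (h r)

  lift-WB : Holds WB 𝔽.frame 𝔽.L → Holds WB frame⁺ LC⁺
  lift-WB h R⊥₁    = top , R⊥₁ , R⊥₁
  lift-WB h R⊥₂    = bot , R⊥₂ , R⊥₂
  lift-WB h R⊤₃    = top , R⊤₃ , R⊤₃
  lift-WB h Rww    = world , Rww , Rww
  lift-WB h (Rι r) with h r
  ... | x , r₁ , r₂ = ι x , Rι r₁ , Rι r₂

  lift-X : Holds X 𝔽.frame 𝔽.L → Holds X frame⁺ LC⁺
  lift-X h (_ , refl , QL⊤)    = ⊥≤
  lift-X h (_ , refl , QLww)   = w≤w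
  lift-X h (_ , refl , QL-L l) = ι≤ι (h l)

  lift-Rd : Holds Rd 𝔽.frame 𝔽.L → Holds Rd frame⁺ LC⁺
  lift-Rd h bot   = R⊥₁
  lift-Rd h top   = R⊥₂
  lift-Rd h world = Rww
  lift-Rd h (ι s) = Rι (h s)

  lift-B : Holds B 𝔽.frame 𝔽.L → Holds B frame⁺ LC⁺
  lift-B h (_ , R⊥₁ , _)      = top , R⊤₃ , R⊥₁
  lift-B h (_ , R⊥₂ , _)      = bot , R⊥₁ , R⊥₂
  lift-B h (_ , _ , R⊥₂)      = bot , R⊥₂ , R⊥₂
  lift-B h (_ , _ , R⊤₃)      = top , R⊤₃ , R⊤₃
  lift-B h (_ , Rww , Rww)    = world , Rww , Rww
  lift-B h (_ , Rι r , Rι r') with h (_ , r , r')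
  ... | y , r₁ , r₂ = ι y , Rι r₁ , Rι r₂

  lift-CB : Holds CB 𝔽.frame 𝔽.L → Holds CB frame⁺ LC⁺
  lift-CB h (_ , R⊥₁ , _)      = bot , R⊥₁ , R⊥₂
  lift-CB h (_ , R⊥₂ , _)      = top , R⊤₃ , R⊥₁
  lift-CB h (_ , _ , R⊥₂)      = bot , R⊥₂ , R⊥₂
  lift-CB h (_ , _ , R⊤₃)      = top , R⊤₃ , R⊤₃
  lift-CB h (_ , Rww , Rww)    = world , Rww , Rww
  lift-CB h (_ , Rι r , Rι r') with h (_ , r , r')
  ... | y , r₁ , r₂ = ι y , Rι r₁ , Rι r₂

  lift-W : Holds W 𝔽.frame 𝔽.L → Holds W frame⁺ LC⁺
  lift-W h R⊥₁    = bot , R⊥₁ , R⊥₁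
  lift-W h R⊥₂    = bot , R⊥₂ , R⊥₁
  lift-W h R⊤₃    = top , R⊤₃ , R⊤₃
  lift-W h Rww    = world , Rww , Rww
  lift-W h (Rι r) with h r
  ... | x , r₁ , r₂ = ι x , Rι r₁ , Rι r₂

  lift-C : Holds C 𝔽.frame 𝔽.L → Holds C frame⁺ LC⁺
  lift-C h (_ , R⊥₁ , _)      = bot , R⊥₁ , R⊥₁
  lift-C h (_ , R⊥₂ , _)      = top , R⊤₃ , R⊥₂
  lift-C h (_ , _ , R⊥₂)      = bot , R⊥₂ , R⊥₁
  lift-C h (_ , _ , R⊤₃)      = top , R⊤₃ , R⊤₃
  lift-C h (_ , Rww , Rww)    = world , Rww , Rww
  lift-C h (_ , Rι r , Rι r') with h (_ , r , r')
  ... | y , r₁ , r₂ = ι y , Rι r₁ , Rι r₂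

  lift-M : Holds M 𝔽.frame 𝔽.L → Holds M frame⁺ LC⁺
  lift-M h R⊥₁    = inj₁ ⊥≤
  lift-M h R⊥₂    = inj₂ ⊥≤
  lift-M h R⊤₃    = inj₁ ≤⊤
  lift-M h Rww    = inj₁ w≤w
  lift-M h (Rι r) with h r
  ... | inj₁ s≤u = inj₁ (ι≤ι s≤u)
  ... | inj₂ t≤u = inj₂ (ι≤ι t≤u)

  lift-ER : Holds ER 𝔽.frame 𝔽.L → Holds ER frame⁺ LC⁺
  lift-ER h bot   = top , (world , refl , QL⊤) , R⊥₁
  lift-ER h top   = top , (world , refl , QL⊤) , R⊤₃
  lift-ER h world = world , (world , refl , QLww) , Rww
  lift-ER h (ι s) with h s
  ... | x , l , r = ι x , (world , refl , QL-L l) , Rι r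

  lift-Nec : Holds Nec 𝔽.frame 𝔽.L → Holds Nec frame⁺ LC⁺
  lift-Nec h (_ , refl , _)      Q⊤     = world , refl , QL⊤
  lift-Nec h (_ , refl , QLww)    Qww    = world , refl , QLww
  lift-Nec h (_ , refl , QL-L l)  (Qι q) = world , refl , QL-L (h l q)

  lift-BoxK : Holds BoxK 𝔽.frame 𝔽.L → Holds BoxK frame⁺ LC⁺
  lift-BoxK h (_ , R⊥₁ , _)     = top , Q⊤ , bot , Q⊥ , R⊥₁
  lift-BoxK h (_ , R⊥₂ , _)     = bot , Q⊥ , top , Q⊤ , R⊥₂
  lift-BoxK h (_ , _ , Q⊤)      = top , Q⊤ , top , Q⊤ , R⊤₃
  lift-BoxK h (_ , Rww , Qww)   = world , Qww , world , Qww , Rww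
  lift-BoxK h (_ , Rι r , Qι q) with h (_ , r , q)
  ... | x , q₁ , y , q₂ , r₂ = ι x , Qι q₁ , ι y , Qι q₂ , Rι r₂

  lift-BoxT : Holds BoxT 𝔽.frame 𝔽.L → Holds BoxT frame⁺ LC⁺
  lift-BoxT h bot   = Q⊥
  lift-BoxT h top   = Q⊤
  lift-BoxT h world = Qww
  lift-BoxT h (ι s) = Qι (h s)

  lift-BoxD : Holds BoxD 𝔽.frame 𝔽.L → Holds BoxD frame⁺ LC⁺
  lift-BoxD h bot   = top , Q⊥ , Q⊤
  lift-BoxD h top   = bot , Q⊤ , Q⊥
  lift-BoxD h world = world , Qww , Qww
  lift-BoxD h (ι s) with h s
  ... | x , q₁ , q₂ = ι x , Qι q₁ , Qι q₂

  lift-Box4 : Holds Box4 𝔽.frame 𝔽.L → Holds Box4 frame⁺ LC⁺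
  lift-Box4 h Q⊥     _      = Q⊥
  lift-Box4 h _      Q⊤     = Q⊤
  lift-Box4 h Qww    Qww    = Qww
  lift-Box4 h (Qι q) (Qι o) = Qι (h q o)

  lift-Box5 : Holds Box5 𝔽.frame 𝔽.L → Holds Box5 frame⁺ LC⁺
  lift-Box5 h _      Q⊤     = Q⊥
  lift-Box5 h Q⊤     Q⊥     = Q⊤
  lift-Box5 h q      Qww    = q
  lift-Box5 h Q⊤     (Qι _) = Q⊤
  lift-Box5 h (Qι q) (Qι o) = Qι (h q o)

  holds-lift : ∀ c → Holds c 𝔽.frame 𝔽.L → Holds c frame⁺ LC⁺
  holds-lift DN   = lift-DN
  holds-lift Cp   = lift-Cp
  holds-lift WB   = lift-WB
  holds-lift X    = lift-X
  holds-lift Rd   = lift-Rd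
  holds-lift B    = lift-B
  holds-lift CB   = lift-CB
  holds-lift W    = lift-W
  holds-lift C    = lift-C
  holds-lift M    = lift-M
  holds-lift ER   = lift-ER
  holds-lift Nec  = lift-Nec
  holds-lift BoxK = lift-BoxK
  holds-lift BoxT = lift-BoxT
  holds-lift BoxD = lift-BoxD
  holds-lift Box4 = lift-Box4
  holds-lift Box5 = lift-Box5

module ExtendedModel (Mo : LModel) where
  open LModel Mo using (lframe; V; V-up; L) renaming (⟦_⟧ to ⟦_⟧ᴹ)
  open Extension lframe
  open Equivalence using (to; from)

  V⁺ : ℕ → S⁺ → Set
  V⁺ p bot   = ⊥
  V⁺ p top   = ⊤
  V⁺ p world = ⊥
  V⁺ p (ι s) = V p s

  V⁺-up : ∀ p → UpSet frame⁺ (V⁺ p)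
  V⁺-up p ⊥≤      ()
  V⁺-up p ≤⊤      _  = tt
  V⁺-up p w≤w     v  = v
  V⁺-up p (ι≤ι o) v  = V-up p o v

  model⁺ : WModel
  model⁺ = record { wframe = wframe⁺ ; V = V⁺ ; V-up = V⁺-up ; V-top = λ _ → tt ; V-bot = λ _ v → v }

  open WModel model⁺ using (⟦_⟧)

  ι-truth : ∀ φ s → ⟦ φ ⟧ᴹ s ⇔ ⟦ φ ⟧ (ι s)
  ι-truth (atom p)  s = ⇔-id _
  ι-truth (and φ ψ) s = ι-truth φ s ×-⇔ ι-truth ψ s
  ι-truth (or φ ψ)  s = ι-truth φ s ⊎-⇔ ι-truth ψ s
  ι-truth (neg φ)   s = ¬-cong-⇔ (ι-truth φ _)
  ι-truth (imp φ ψ) s = mk⇔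
    (λ f → λ { _ _ R⊥₂ φ⊥ → ⊥-elim (bot-satisfies-none model⁺ φ φ⊥)
             ; _ _ R⊤₃ _  → top-satisfies-all model⁺ ψ
             ; _ _ (Rι r) φt → to (ι-truth ψ _) (f _ _ r (from (ι-truth φ _) φt)) })
    (λ f t u r φt → from (ι-truth ψ u) (f _ _ (Rι r) (to (ι-truth φ t) φt)))
  ι-truth (box φ) s = mk⇔
    (λ f → λ { _ Q⊤ → top-satisfies-all model⁺ φ ; _ (Qι q) → to (ι-truth φ _) (f _ q) })
    (λ f t q → from (ι-truth φ t) (f _ (Qι q)))
  ι-truth (boxL φ) s = mk⇔
    (λ f → λ { _ QL⊤ → top-satisfies-all model⁺ φ ; _ (QLι q) → to (ι-truth φ _) (f _ q) })
    (λ f t q → from (ι-truth φ t) (f _ (QLι q)))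

  boxL-refuted : ∀ φ → ¬ ValidL Mo φ → ¬ ValidW model⁺ (boxL φ)
  boxL-refuted φ invalid valid⁺ =
    invalid λ s l → from (ι-truth φ s) (valid⁺ world refl (ι s) (QL-L l))

proposition4p9 : (Φ : Cond → Set) (Mo : LModel) → HoldsL Φ Mo →
    Σ WModel λ Mo' → HoldsC Φ Mo' ×
      Σ (LModel.S Mo → WModel.S Mo') λ ι →
        (∀ {s t} → ι s ≡ ι t → s ≡ t) ×
        (∃[ s' ] (∀ s → ¬ (ι s ≡ s'))) ×
        (∀ φ →
          (∀ s → (LModel.⟦_⟧ Mo φ s ⇔ WModel.⟦_⟧ Mo' φ (ι s))) ×
          (¬ ValidL Mo φ → ¬ ValidW Mo' (boxL φ)))
proposition4p9 Φ Mo holdsL =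
  model⁺ , (λ c Φc → holds-lift c (holdsL c Φc)) , ι , ι-injective , (world , world-∉-image) ,
  λ φ → ι-truth φ , boxL-refuted φ
  where
  open ExtendedModel Mo
  open Extension (LModel.lframe Mo)
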